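{- Let $p\ge 3$ be a prime, let $\alpha\ge 0$ and $k\ge 1$ be integers, and let $m=p^{\alpha}k$. Define integers $d_m(n)$ by $$\frac{1}{(1-x)^{m}}\prod_{i=0}^{\infty}\frac{1}{(1-x^{p^{i}})^{(p-1)m}}=\sum_{n=0}^{\infty}d_{m}(n)x^{n}.$$ Then for every integer $n\ge 1$, $$d_m(pn)\equiv d_m(n)\pmod{p^{\alpha+2}}.$$ -}

module Defs where

open import Data.Nat using (ℕ; zero; suc; _+_; _*_; _∸_; _^_)
open import Data.Nat.Divisibility using (_∣?_)
open import Data.List using (map; upTo)
open import Data.Nat.ListAction using (sum)
open import Data.Bool using (if_then_else_)
open import Relation.Nullary.Decidable using (⌊_⌋)

Series : Set
Series = ℕ → ℕ

one : Series
one zero    = 1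
one (suc _) = 0

_⊛_ : Series → Series → Series
(f ⊛ g) n = sum (map (λ i → f i * g (n ∸ i)) (upTo (suc n)))

infixl 7 _⊛_

_^ˢ_ : Series → ℕ → Series
f ^ˢ zero  = one
f ^ˢ suc e = f ⊛ (f ^ˢ e)

-- 1 / (1 - x^j) = Σ_{t ≥ 0} x^{j t}  (coefficient of x^n is 1 iff j ∣ n)
invOneMinusX^ : ℕ → Series
invOneMinusX^ j n = if ⌊ j ∣? n ⌋ then 1 else 0

partialProd : ℕ → ℕ → ℕ → Series
partialProd p e zero    = one
partialProd p e (suc N) = partialProd p e N ⊛ (invOneMinusX^ (p ^ N) ^ˢ e)

genTrunc : ℕ → ℕ → ℕ → Series
genTrunc p m N = (invOneMinusX^ 1 ^ˢ m) ⊛ partialProd p ((p ∸ 1) * m) N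

-- d_m(n): the coefficient of x^n in the infinite product.  Factors with
-- p^i > n (in particular all i ≥ n+1, as p ≥ 2) are ≡ 1 mod x^{n+1}, so
-- truncating at N = n+1 gives the exact coefficient.
d : ℕ → ℕ → ℕ → ℕ
d p m n = genTrunc p m (suc n) n

module Submission where

-- Write F = (1 − x)⁻ᵐ ∏ᵢ (1 − x^(pⁱ))^(−(p−1)m), D = (1 − x)⁻ᵖᵐ and E = (1 − xᵖ)⁻ᵐ.
-- Splitting off the factor i = 0 gives the functional equation F(x) E(x) = D(x) F(xᵖ).
-- Atkin's operator U (keep the coefficients at multiples of p) is multiplicative
-- against series in xᵖ, so applying it yields (1 − x)⁻ᵐ (U F − F) = F · U(D − E);
-- as (1 − x)⁻ᵐ is a unit, d(pn) ≡ d(n) modulo every q dividing the coefficients of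
-- D − E at multiples of p.  For m = pᵅk, D and E are the pᵅk-th powers of (1 − x)⁻ᵖ
-- and (1 − xᵖ)⁻¹, which for odd p agree modulo p, and modulo p² at multiples of p.
-- By the binomial theorem, raising to the p-th power lifts such a congruence by one
-- power of p, so D and E agree modulo p^(α+2) at multiples of p.  The product is
-- handled through its truncations, which stabilise coefficientwise.

open import Defs

module DmCongruence where

  open import Algebra.Bundles using (CommutativeRing)
  open import Algebra.Structures using (IsCommutativeRing)
  import Algebra.Construct.Pointwise as Pointwise
  open import Algebra.Solver.Ring.AlmostCommutativeRing
    using (_-Raw-AlmostCommutative⟶_; fromCommutativeRing)
  import Algebra.Solver.Ring
  open import Data.Nat as ℕ using (ℕ; zero; suc; _≤_; _<_; z≤n; s≤s; _∸_; _/_; NonZero)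
  import Data.Nat.Properties as ℕ
  open import Data.Nat.DivMod using (m*n/n≡m)
  open import Data.Nat.Divisibility as ℕ∣ using (divides; _∣?_) renaming (_∣_ to _∣ℕ_)
  open import Data.Nat.Induction using (<-rec)
  open import Data.Nat.ListAction using (sum)
  open import Data.Nat.Combinatorics using (_C_; nCk+nC[k+1]≡[n+1]C[k+1]; nC1≡n; nCn≡1)
  open import Data.Nat.Combinatorics.Specification using (k>n⇒nCk≡0)
  open import Data.Nat.Primality
    using (Prime; euclidsLemma; prime⇒irreducible; prime⇒nonZero; prime⇒nonTrivial)
  open import Data.Integer using (ℤ; +_; _+_; _*_; -_; _-_; 0ℤ; 1ℤ; -1ℤ) renaming (_^_ to _ℤ^_)
  import Data.Integer.Properties as ℤ
  open import Data.Integer.Divisibility.Signed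
    using ( _∣_; ∣ᵤ⇒∣; ∣-refl; ∣-trans; ∣-reflexive; ∣m∣n⇒∣m+n; ∣m⇒∣-m; ∣m∣n⇒∣m-n; ∣m+n∣n⇒∣m
          ; ∣n⇒∣m*n; ∣m⇒∣m*n; *-monoʳ-∣; *-monoˡ-∣; 0∣⇒≡0)
  open import Data.Integer.Tactic.RingSolver using (solve-∀)
  open import Data.Fin as Fin using (Fin; toℕ)
  open import Data.Fin.Properties using (toℕ<n)
  import Data.List.Properties as List
  open import Data.Empty using (⊥-elim)
  open import Data.Maybe using (Maybe; just; nothing)
  open import Data.Product using (_,_; proj₁; proj₂) renaming (_×_ to _∧_)
  open import Data.Sum using (_⊎_; inj₁; inj₂)
  open import Relation.Nullary using (¬_; Dec; yes; no)
  open import Relation.Binary.Definitions using (tri<; tri≈; tri>)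
  open import Relation.Binary.PropositionalEquality
    using (_≡_; refl; sym; trans; cong; cong₂; subst; subst₂; module ≡-Reasoning)

  PowerSeries : Set
  PowerSeries = ℕ → ℤ

  infix  4 _≋_
  infixl 6 _⊕_
  infixl 7 _⊙_ _⋆_
  infix  8 ⊖_

  _≋_ : PowerSeries → PowerSeries → Set
  f ≋ g = ∀ n → f n ≡ g n

  _⊕_ : PowerSeries → PowerSeries → PowerSeries
  (f ⊕ g) n = f n + g n

  ⊖_ : PowerSeries → PowerSeries
  (⊖ f) n = - f n

  𝟘 𝟙 : PowerSeries
  𝟘 _ = 0ℤ
  𝟙 zero    = 1ℤ
  𝟙 (suc _) = 0ℤ

  tail : PowerSeries → PowerSeries
  tail f n = f (suc n)

  _⋆_ : ℤ → PowerSeries → PowerSeries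
  (c ⋆ f) n = c * f n

  _⊙_ : PowerSeries → PowerSeries → PowerSeries
  (f ⊙ g) zero    = f 0 * g 0
  (f ⊙ g) (suc n) = f 0 * g (suc n) + (tail f ⊙ g) n

  ⊙-cong : ∀ {f f′ g g′} → f ≋ f′ → g ≋ g′ → f ⊙ g ≋ f′ ⊙ g′
  ⊙-cong f≋f′ g≋g′ zero    = cong₂ _*_ (f≋f′ 0) (g≋g′ 0)
  ⊙-cong f≋f′ g≋g′ (suc n) =
    cong₂ _+_ (cong₂ _*_ (f≋f′ 0) (g≋g′ (suc n))) (⊙-cong (λ m → f≋f′ (suc m)) g≋g′ n)

  ⊙-distribʳ : ∀ h f g → (f ⊕ g) ⊙ h ≋ f ⊙ h ⊕ g ⊙ h
  ⊙-distribʳ h f g zero    = ℤ.*-distribʳ-+ (h 0) (f 0) (g 0)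
  ⊙-distribʳ h f g (suc n) =
    trans (cong (_+_ ((f 0 + g 0) * h (suc n))) (⊙-distribʳ h (tail f) (tail g) n))
          (shuffle (f 0) (g 0) (h (suc n)) _ _)
    where
    shuffle : ∀ a b c x y → (a + b) * c + (x + y) ≡ (a * c + x) + (b * c + y)
    shuffle = solve-∀

  ⊙-distribˡ : ∀ h f g → h ⊙ (f ⊕ g) ≋ h ⊙ f ⊕ h ⊙ g
  ⊙-distribˡ h f g zero    = ℤ.*-distribˡ-+ (h 0) (f 0) (g 0)
  ⊙-distribˡ h f g (suc n) =
    trans (cong (_+_ (h 0 * (f (suc n) + g (suc n)))) (⊙-distribˡ (tail h) f g n))
          (shuffle (h 0) (f (suc n)) (g (suc n)) _ _)
    where
    shuffle : ∀ a b c x y → a * (b + c) + (x + y) ≡ (a * b + x) + (a * c + y)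
    shuffle = solve-∀

  ⋆-⊙ : ∀ c f g → (c ⋆ f) ⊙ g ≋ c ⋆ (f ⊙ g)
  ⋆-⊙ c f g zero    = ℤ.*-assoc c (f 0) (g 0)
  ⋆-⊙ c f g (suc n) =
    trans (cong (_+_ (c * f 0 * g (suc n))) (⋆-⊙ c (tail f) g n))
          (factor c (f 0) (g (suc n)) _)
    where
    factor : ∀ c a b x → c * a * b + c * x ≡ c * (a * b + x)
    factor = solve-∀

  ⊙-assoc : ∀ f g h → (f ⊙ g) ⊙ h ≋ f ⊙ (g ⊙ h)
  ⊙-assoc f g h zero    = ℤ.*-assoc (f 0) (g 0) (h 0)
  ⊙-assoc f g h (suc n) = begin
    f 0 * g 0 * h (suc n) + ((f 0 ⋆ tail g ⊕ tail f ⊙ g) ⊙ h) n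
      ≡⟨ cong (_+_ (f 0 * g 0 * h (suc n))) (⊙-distribʳ h (f 0 ⋆ tail g) (tail f ⊙ g) n) ⟩
    f 0 * g 0 * h (suc n) + (((f 0 ⋆ tail g) ⊙ h) n + ((tail f ⊙ g) ⊙ h) n)
      ≡⟨ cong (_+_ (f 0 * g 0 * h (suc n))) (cong₂ _+_ (⋆-⊙ (f 0) (tail g) h n) (⊙-assoc (tail f) g h n)) ⟩
    f 0 * g 0 * h (suc n) + (f 0 * (tail g ⊙ h) n + (tail f ⊙ (g ⊙ h)) n)
      ≡⟨ shuffle (f 0) (g 0) (h (suc n)) _ _ ⟩
    f 0 * (g 0 * h (suc n) + (tail g ⊙ h) n) + (tail f ⊙ (g ⊙ h)) n ∎
    where
    open ≡-Reasoning
    shuffle : ∀ a b c x y → a * b * c + (a * x + y) ≡ a * (b * c + x) + y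
    shuffle = solve-∀

  ⊙-comm : ∀ f g → f ⊙ g ≋ g ⊙ f
  ⊙-comm f g zero          = ℤ.*-comm (f 0) (g 0)
  ⊙-comm f g (suc zero)    = swap (f 0) (g 1) (f 1) (g 0)
    where
    swap : ∀ a b c d → a * b + c * d ≡ d * c + b * a
    swap = solve-∀
  ⊙-comm f g (suc (suc n)) = begin
    f 0 * g (2 ℕ.+ n) + (tail f ⊙ g) (suc n)
      ≡⟨ cong (_+_ (f 0 * g (2 ℕ.+ n))) (⊙-comm (tail f) g (suc n)) ⟩
    f 0 * g (2 ℕ.+ n) + (g 0 * f (2 ℕ.+ n) + (tail g ⊙ tail f) n)
      ≡⟨ cong (λ t → f 0 * g (2 ℕ.+ n) + (g 0 * f (2 ℕ.+ n) + t)) (⊙-comm (tail g) (tail f) n) ⟩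
    f 0 * g (2 ℕ.+ n) + (g 0 * f (2 ℕ.+ n) + (tail f ⊙ tail g) n)
      ≡⟨ swap (f 0) (g (2 ℕ.+ n)) (g 0) (f (2 ℕ.+ n)) _ ⟩
    g 0 * f (2 ℕ.+ n) + (f 0 * g (2 ℕ.+ n) + (tail f ⊙ tail g) n)
      ≡⟨ cong (_+_ (g 0 * f (2 ℕ.+ n))) (⊙-comm (tail g) f (suc n)) ⟨
    g 0 * f (2 ℕ.+ n) + (tail g ⊙ f) (suc n) ∎
    where
    open ≡-Reasoning
    swap : ∀ a b c d x → a * b + (c * d + x) ≡ c * d + (a * b + x)
    swap = solve-∀

  𝟙-positive : ∀ {n} → 0 < n → 𝟙 n ≡ 0ℤ
  𝟙-positive {suc n} _ = refl

  ⊙-zeroˡ : ∀ g → 𝟘 ⊙ g ≋ 𝟘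
  ⊙-zeroˡ g zero    = ℤ.*-zeroˡ (g 0)
  ⊙-zeroˡ g (suc n) = cong₂ _+_ (ℤ.*-zeroˡ (g (suc n))) (⊙-zeroˡ g n)

  ⊙-identityˡ : ∀ g → 𝟙 ⊙ g ≋ g
  ⊙-identityˡ g zero    = ℤ.*-identityˡ (g 0)
  ⊙-identityˡ g (suc n) =
    trans (cong₂ _+_ (ℤ.*-identityˡ (g (suc n))) (⊙-zeroˡ g n)) (ℤ.+-identityʳ _)

  ⊙-identityʳ : ∀ g → g ⊙ 𝟙 ≋ g
  ⊙-identityʳ g n = trans (⊙-comm g 𝟙 n) (⊙-identityˡ g n)

  ⊙-isCommutativeRing : IsCommutativeRing _≋_ _⊕_ _⊙_ ⊖_ 𝟘 𝟙
  ⊙-isCommutativeRing = record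
    { isRing = record
      { +-isAbelianGroup = Pointwise.isAbelianGroup ℕ ℤ.+-0-isAbelianGroup
      ; *-cong           = ⊙-cong
      ; *-assoc          = ⊙-assoc
      ; *-identity       = ⊙-identityˡ , ⊙-identityʳ
      ; distrib          = ⊙-distribˡ , ⊙-distribʳ
      }
    ; *-comm = ⊙-comm
    }

  powerSeriesRing : CommutativeRing _ _
  powerSeriesRing = record { isCommutativeRing = ⊙-isCommutativeRing }

  open CommutativeRing powerSeriesRing
    using (+-cong; *-cong; *-congˡ; *-congʳ; *-assoc; *-comm; setoid)
    renaming (refl to ≋-refl; reflexive to ≋-reflexive; sym to ≋-sym; trans to ≋-trans)
  open import Algebra.Properties.CommutativeSemiring.Exp (CommutativeRing.commutativeSemiring powerSeriesRing)
    using (_^_; ^-congˡ; ^-congʳ; ^-homo-*; ^-assocʳ; ^-distrib-*)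
  open import Algebra.Properties.Ring (CommutativeRing.ring powerSeriesRing)
    using (x[y-z]≈xy-xz)
  open import Algebra.Properties.CommutativeSemiring.Binomial (CommutativeRing.commutativeSemiring powerSeriesRing)
    using (binomialTerm) renaming (theorem to binomial-theorem)
  open import Algebra.Definitions.RawMonoid (CommutativeRing.+-rawMonoid powerSeriesRing)
    using (_×_) renaming (sum to Σₛ)
  import Relation.Binary.Reasoning.Setoid setoid as ≋-Reasoning

  constant : ℤ → PowerSeries
  constant c zero    = c
  constant c (suc _) = 0ℤ

  constant-homomorphism :
    CommutativeRing.rawRing ℤ.+-*-commutativeRing -Raw-AlmostCommutative⟶ fromCommutativeRing powerSeriesRing
  constant-homomorphism = record
    { ⟦_⟧    = constant
    ; +-homo = λ { a b zero → refl ; a b (suc n) → refl }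
    ; *-homo = *-homo
    ; -‿homo = λ { a zero → refl ; a (suc n) → refl }
    ; 0-homo = λ { zero → refl ; (suc n) → refl }
    ; 1-homo = λ { zero → refl ; (suc n) → refl }
    }
    where
    *-homo : ∀ a b → constant (a * b) ≋ constant a ⊙ constant b
    *-homo a b zero    = refl
    *-homo a b (suc n) = sym (cong₂ _+_ (ℤ.*-zeroʳ a) (⊙-zeroˡ (constant b) n))

  constant-≟ : ∀ a b → Maybe (constant a ≋ constant b)
  constant-≟ a b with a ℤ.≟ b
  ... | yes refl = just ≋-refl
  ... | no  _    = nothing

  -- Integer constants serve as coefficients, so that the normaliser can cancel them.
  module ⊙-Solver = Algebra.Solver.Ring _ (fromCommutativeRing powerSeriesRing) constant-homomorphism constant-≟

  infix 4 _∣ₛ_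

  _∣ₛ_ : ℤ → PowerSeries → Set
  q ∣ₛ f = ∀ n → q ∣ f n

  ∣-⊙-termwise : ∀ {q} f g n → (∀ i → i ≤ n → q ∣ f i * g (n ∸ i)) → q ∣ (f ⊙ g) n
  ∣-⊙-termwise f g zero    q∣term = q∣term 0 z≤n
  ∣-⊙-termwise f g (suc n) q∣term =
    ∣m∣n⇒∣m+n (q∣term 0 z≤n) (∣-⊙-termwise (tail f) g n (λ i i≤n → q∣term (suc i) (s≤s i≤n)))

  ⊙-termwise-zero : ∀ f g n → (∀ i → i ≤ n → f i * g (n ∸ i) ≡ 0ℤ) → (f ⊙ g) n ≡ 0ℤ
  ⊙-termwise-zero f g n term≡0 =
    0∣⇒≡0 (∣-⊙-termwise f g n (λ i i≤n → ∣-reflexive (sym (term≡0 i i≤n))))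

  ⊙-termwise-cong : ∀ f g f′ g′ n → (∀ i → i ≤ n → f i * g (n ∸ i) ≡ f′ i * g′ (n ∸ i)) →
                    (f ⊙ g) n ≡ (f′ ⊙ g′) n
  ⊙-termwise-cong f g f′ g′ zero    term≡ = term≡ 0 z≤n
  ⊙-termwise-cong f g f′ g′ (suc n) term≡ = cong₂ _+_ (term≡ 0 z≤n)
    (⊙-termwise-cong (tail f) g (tail f′) g′ n (λ i i≤n → term≡ (suc i) (s≤s i≤n)))

  ∣ₛ-resp-≋ : ∀ {q f g} → f ≋ g → q ∣ₛ f → q ∣ₛ g
  ∣ₛ-resp-≋ f≋g q∣f n = subst (_ ∣_) (f≋g n) (q∣f n)

  ∣ₛ-⊕ : ∀ {q f g} → q ∣ₛ f → q ∣ₛ g → q ∣ₛ f ⊕ g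
  ∣ₛ-⊕ q∣f q∣g n = ∣m∣n⇒∣m+n (q∣f n) (q∣g n)

  ∣ₛ-⊖ : ∀ {q f} → q ∣ₛ f → q ∣ₛ ⊖ f
  ∣ₛ-⊖ q∣f n = ∣m⇒∣-m (q∣f n)

  ∣ₛ-⊙ˡ : ∀ {q f} g → q ∣ₛ f → q ∣ₛ f ⊙ g
  ∣ₛ-⊙ˡ {f = f} g q∣f n = ∣-⊙-termwise f g n (λ i _ → ∣m⇒∣m*n (g (n ∸ i)) (q∣f i))

  ∣ₛ-⊙ʳ : ∀ {q g} f → q ∣ₛ g → q ∣ₛ f ⊙ g
  ∣ₛ-⊙ʳ {g = g} f q∣g n = ∣-⊙-termwise f g n (λ i _ → ∣n⇒∣m*n (f i) (q∣g (n ∸ i)))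

  *-pres-∣ : ∀ {a b x y} → a ∣ x → b ∣ y → a * b ∣ x * y
  *-pres-∣ {a} {b} {x} {y} a∣x b∣y = ∣-trans (*-monoˡ-∣ b a∣x) (*-monoʳ-∣ x b∣y)

  ∣ₛ-⊙ : ∀ {a b f g} → a ∣ₛ f → b ∣ₛ g → a * b ∣ₛ f ⊙ g
  ∣ₛ-⊙ {f = f} {g} a∣f b∣g n = ∣-⊙-termwise f g n (λ i _ → *-pres-∣ (a∣f i) (b∣g (n ∸ i)))

  -- c n is recovered from e ⊙ c as (e ⊙ c) n − Σ_{0<i≤n} e i · c (n − i).
  ∣ₛ-cancel-unitˡ : ∀ {q} e c → e 0 ≡ 1ℤ → q ∣ₛ e ⊙ c → q ∣ₛ c
  ∣ₛ-cancel-unitˡ {q} e c e₀≡1 q∣ec = <-rec (λ n → q ∣ c n) step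
    where
    q∣e₀c : ∀ n → q ∣ (e 0 * c n) → q ∣ c n
    q∣e₀c n = subst (q ∣_) (trans (cong (_* c n) e₀≡1) (ℤ.*-identityˡ (c n)))
    step : ∀ n → (∀ {m} → m < n → q ∣ c m) → q ∣ c n
    step zero    _   = q∣e₀c 0 (q∣ec 0)
    step (suc n) q∣c<n = q∣e₀c (suc n) (∣m+n∣n⇒∣m (q∣ec (suc n))
      (∣-⊙-termwise (tail e) c n (λ i _ → ∣n⇒∣m*n (e (suc i)) (q∣c<n (s≤s (ℕ.m∸n≤m n i))))))

  drop : ℕ → PowerSeries → PowerSeries
  drop k f i = f (k ℕ.+ i)

  ⊙-drop : ∀ k g f n → (∀ i → i < k → g i ≡ 0ℤ) → (g ⊙ f) (k ℕ.+ n) ≡ (drop k g ⊙ f) n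
  ⊙-drop zero    g f n _      = refl
  ⊙-drop (suc k) g f n g<k≡0 = begin
    g 0 * f (suc k ℕ.+ n) + rest ≡⟨ cong (λ c → c * f (suc k ℕ.+ n) + rest) (g<k≡0 0 (s≤s z≤n)) ⟩
    0ℤ + rest                    ≡⟨ ℤ.+-identityˡ rest ⟩
    rest                         ≡⟨ ⊙-drop k (tail g) f n (λ i i<k → g<k≡0 (suc i) (s≤s i<k)) ⟩
    (drop (suc k) g ⊙ f) n       ∎
    where
    open ≡-Reasoning
    rest = (tail g ⊙ f) (k ℕ.+ n)

  ⊙-at-multiples : ∀ p .{{_ : NonZero p}} g f → (∀ i → ¬ p ∣ℕ i → g i ≡ 0ℤ) →
                   ∀ s → (g ⊙ f) (s ℕ.* p) ≡ ((λ t → g (t ℕ.* p)) ⊙ (λ t → f (t ℕ.* p))) s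
  ⊙-at-multiples p       g f g∈ zero    = refl
  ⊙-at-multiples (suc k) g f g∈ (suc s) = cong (_+_ (g 0 * f (suc s ℕ.* suc k))) (begin
    (tail g ⊙ f) (k ℕ.+ s ℕ.* suc k)        ≡⟨ ⊙-drop k (tail g) f (s ℕ.* suc k) tail-g<k≡0 ⟩
    (drop (suc k) g ⊙ f) (s ℕ.* suc k)      ≡⟨ ⊙-at-multiples (suc k) (drop (suc k) g) f drop-g∈ s ⟩
    ((λ t → g (suc t ℕ.* suc k)) ⊙ (λ t → f (t ℕ.* suc k))) s ∎)
    where
    open ≡-Reasoning
    tail-g<k≡0 : ∀ i → i < k → tail g i ≡ 0ℤ
    tail-g<k≡0 i i<k = g∈ (suc i) (ℕ∣.>⇒∤ (s≤s i<k))
    drop-g∈ : ∀ i → ¬ suc k ∣ℕ i → drop (suc k) g i ≡ 0ℤ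
    drop-g∈ i p∤i = g∈ (suc k ℕ.+ i) (λ p∣p+i → p∤i (ℕ∣.∣m+n∣m⇒∣n p∣p+i ℕ∣.∣-refl))

  infix 4 _≋[<_]_

  _≋[<_]_ : PowerSeries → ℕ → PowerSeries → Set
  f ≋[< M ] g = ∀ n → n < M → f n ≡ g n

  ⊙-cong-< : ∀ {M f f′ g g′} → f ≋[< M ] f′ → g ≋[< M ] g′ → f ⊙ g ≋[< M ] f′ ⊙ g′
  ⊙-cong-< {f = f} {f′} {g} {g′} f≋f′ g≋g′ n n<M = ⊙-termwise-cong f g f′ g′ n λ i i≤n →
    cong₂ _*_ (f≋f′ i (ℕ.≤-<-trans i≤n n<M)) (g≋g′ (n ∸ i) (ℕ.≤-<-trans (ℕ.m∸n≤m n i) n<M))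

  ^-cong-< : ∀ {M f g} e → f ≋[< M ] g → f ^ e ≋[< M ] g ^ e
  ^-cong-< zero    f≋g n n<M = refl
  ^-cong-< (suc e) f≋g       = ⊙-cong-< f≋g (^-cong-< e f≋g)

  𝟙^≋𝟙 : ∀ e → 𝟙 ^ e ≋ 𝟙
  𝟙^≋𝟙 zero    = ≋-refl
  𝟙^≋𝟙 (suc e) = ≋-trans (*-congˡ (𝟙^≋𝟙 e)) (⊙-identityˡ 𝟙)

  ⊛-suc : ∀ f g n → (f ⊛ g) (suc n) ≡ f 0 ℕ.* g (suc n) ℕ.+ ((λ i → f (suc i)) ⊛ g) n
  ⊛-suc f g n = cong (λ xs → f 0 ℕ.* g (suc n) ℕ.+ sum xs)
    (trans (List.map-applyUpTo suc (λ i → f i ℕ.* g (suc n ∸ i)) (suc n))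
           (sym (List.map-applyUpTo (λ i → i) (λ i → f (suc i) ℕ.* g (n ∸ i)) (suc n))))

  toℤ : Series → PowerSeries
  toℤ f n = + f n

  toℤ-⊛ : ∀ f g → toℤ (f ⊛ g) ≋ toℤ f ⊙ toℤ g
  toℤ-⊛ f g zero    = trans (cong +_ (ℕ.+-identityʳ _)) (ℤ.pos-* (f 0) (g 0))
  toℤ-⊛ f g (suc n) = begin
    + (f ⊛ g) (suc n)                                            ≡⟨ cong +_ (⊛-suc f g n) ⟩
    + (f 0 ℕ.* g (suc n) ℕ.+ ((λ i → f (suc i)) ⊛ g) n)          ≡⟨ ℤ.pos-+ (f 0 ℕ.* g (suc n)) _ ⟩
    + (f 0 ℕ.* g (suc n)) + + ((λ i → f (suc i)) ⊛ g) n          ≡⟨ cong₂ _+_ (ℤ.pos-* (f 0) (g (suc n))) (toℤ-⊛ (λ i → f (suc i)) g n) ⟩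
    + f 0 * + g (suc n) + (tail (toℤ f) ⊙ toℤ g) n               ∎
    where open ≡-Reasoning

  toℤ-one : toℤ one ≋ 𝟙
  toℤ-one zero    = refl
  toℤ-one (suc n) = refl

  toℤ-^ˢ : ∀ f e → toℤ (f ^ˢ e) ≋ toℤ f ^ e
  toℤ-^ˢ f zero    = toℤ-one
  toℤ-^ˢ f (suc e) = ≋-trans (toℤ-⊛ f (f ^ˢ e)) (*-congˡ (toℤ-^ˢ f e))

  geometric : ℕ → PowerSeries
  geometric j = toℤ (invOneMinusX^ j)

  geometric-∣ : ∀ {j n} → j ∣ℕ n → geometric j n ≡ 1ℤ
  geometric-∣ {j} {n} j∣n with j ∣? n
  ... | yes _   = refl
  ... | no  j∤n = ⊥-elim (j∤n j∣n)

  geometric-∤ : ∀ {j n} → ¬ j ∣ℕ n → geometric j n ≡ 0ℤ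
  geometric-∤ {j} {n} j∤n with j ∣? n
  ... | yes j∣n = ⊥-elim (j∤n j∣n)
  ... | no  _   = refl

  geometric≋[<]𝟙 : ∀ j .{{_ : NonZero j}} → geometric j ≋[< j ] 𝟙
  geometric≋[<]𝟙 j zero    _   = geometric-∣ (j ℕ∣.∣0)
  geometric≋[<]𝟙 j (suc n) n<j = geometric-∤ (ℕ∣.>⇒∤ n<j)

  module AtkinOperators (p : ℕ) .{{_ : NonZero p}} where

    -- Atkin's operators: U f = Σ f(pn) xⁿ and V f = f(xᵖ).
    U : PowerSeries → PowerSeries
    U f s = f (s ℕ.* p)

    V : PowerSeries → PowerSeries
    V f n with p ∣? n
    ... | yes _ = f (n / p)
    ... | no  _ = 0ℤ

    InXᵖ : PowerSeries → Set
    InXᵖ f = ∀ n → ¬ p ∣ℕ n → f n ≡ 0ℤ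

    U-cong : ∀ {f g} → f ≋ g → U f ≋ U g
    U-cong f≋g s = f≋g (s ℕ.* p)

    U-⊙ : ∀ {g} f → InXᵖ g → U (g ⊙ f) ≋ U g ⊙ U f
    U-⊙ {g} f g∈ = ⊙-at-multiples p g f g∈

    U∘V : ∀ f → U (V f) ≋ f
    U∘V f s with p ∣? (s ℕ.* p)
    ... | yes _   = cong f (m*n/n≡m s p)
    ... | no  p∤ = ⊥-elim (p∤ (ℕ∣.n∣m*n s))

    InXᵖ-V : ∀ f → InXᵖ (V f)
    InXᵖ-V f n p∤n with p ∣? n
    ... | yes p∣n = ⊥-elim (p∤n p∣n)
    ... | no  _   = refl

    InXᵖ-resp-≋ : ∀ {f g} → f ≋ g → InXᵖ f → InXᵖ g
    InXᵖ-resp-≋ f≋g f∈ n p∤n = trans (sym (f≋g n)) (f∈ n p∤n)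

    InXᵖ-ext : ∀ {f g} → InXᵖ f → InXᵖ g → U f ≋ U g → f ≋ g
    InXᵖ-ext {f} {g} f∈ g∈ Uf≋Ug n with p ∣? n
    ... | yes (divides s refl) = Uf≋Ug s
    ... | no  p∤n              = trans (f∈ n p∤n) (sym (g∈ n p∤n))

    InXᵖ-𝟙 : InXᵖ 𝟙
    InXᵖ-𝟙 zero    p∤0 = ⊥-elim (p∤0 (p ℕ∣.∣0))
    InXᵖ-𝟙 (suc n) _   = refl

    InXᵖ-⊙ : ∀ {f g} → InXᵖ f → InXᵖ g → InXᵖ (f ⊙ g)
    InXᵖ-⊙ {f} {g} f∈ g∈ n p∤n = ⊙-termwise-zero f g n term≡0
      where
      term≡0 : ∀ i → i ≤ n → f i * g (n ∸ i) ≡ 0ℤ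
      term≡0 i i≤n with p ∣? i
      ... | no  p∤i = trans (cong (_* g (n ∸ i)) (f∈ i p∤i)) (ℤ.*-zeroˡ (g (n ∸ i)))
      ... | yes p∣i = trans (cong (f i *_) (g∈ (n ∸ i) p∤n∸i)) (ℤ.*-zeroʳ (f i))
        where
        p∤n∸i : ¬ p ∣ℕ n ∸ i
        p∤n∸i p∣n∸i = p∤n (subst (p ∣ℕ_) (ℕ.m+[n∸m]≡n i≤n) (ℕ∣.∣m∣n⇒∣m+n p∣i p∣n∸i))

    InXᵖ-^ : ∀ {f} n → InXᵖ f → InXᵖ (f ^ n)
    InXᵖ-^ zero    f∈ = InXᵖ-𝟙
    InXᵖ-^ (suc n) f∈ = InXᵖ-⊙ f∈ (InXᵖ-^ n f∈)

    U-𝟙 : U 𝟙 ≋ 𝟙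
    U-𝟙 zero    = refl
    U-𝟙 (suc s) = 𝟙-positive (ℕ.<-≤-trans (ℕ.>-nonZero⁻¹ p) (ℕ.m≤m+n p (s ℕ.* p)))

    V-cong : ∀ {f g} → f ≋ g → V f ≋ V g
    V-cong {f} {g} f≋g = InXᵖ-ext (InXᵖ-V f) (InXᵖ-V g) λ s →
      trans (U∘V f s) (trans (f≋g s) (sym (U∘V g s)))

    V-⊙ : ∀ f g → V (f ⊙ g) ≋ V f ⊙ V g
    V-⊙ f g = InXᵖ-ext (InXᵖ-V (f ⊙ g)) (InXᵖ-⊙ (InXᵖ-V f) (InXᵖ-V g)) λ s → begin
      U (V (f ⊙ g)) s   ≡⟨ U∘V (f ⊙ g) s ⟩
      (f ⊙ g) s         ≡⟨ ⊙-cong (U∘V f) (U∘V g) s ⟨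
      (U (V f) ⊙ U (V g)) s ≡⟨ U-⊙ (V g) (InXᵖ-V f) s ⟨
      U (V f ⊙ V g) s   ∎
      where open ≡-Reasoning

    V-𝟙 : V 𝟙 ≋ 𝟙
    V-𝟙 = InXᵖ-ext (InXᵖ-V 𝟙) InXᵖ-𝟙 λ s → trans (U∘V 𝟙 s) (sym (U-𝟙 s))

    V-^ : ∀ f n → V (f ^ n) ≋ V f ^ n
    V-^ f zero    = V-𝟙
    V-^ f (suc n) = ≋-trans (V-⊙ f (f ^ n)) (*-congˡ (V-^ f n))

    V-geometric : ∀ j → V (geometric j) ≋ geometric (p ℕ.* j)
    V-geometric j = InXᵖ-ext (InXᵖ-V (geometric j)) geometric-pj∈ λ s →
      trans (U∘V (geometric j) s) (sym (U-geometric s))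
      where
      geometric-pj∈ : InXᵖ (geometric (p ℕ.* j))
      geometric-pj∈ n p∤n = geometric-∤ (λ pj∣n → p∤n (ℕ∣.m*n∣⇒m∣ p j pj∣n))
      U-geometric : ∀ s → geometric (p ℕ.* j) (s ℕ.* p) ≡ geometric j s
      U-geometric s with j ∣? s
      ... | yes j∣s = geometric-∣ (subst (p ℕ.* j ∣ℕ_) (ℕ.*-comm p s) (ℕ∣.*-monoʳ-∣ p j∣s))
      ... | no  j∤s = geometric-∤ (λ pj∣sp → j∤s (ℕ∣.*-cancelˡ-∣ p (subst (p ℕ.* j ∣ℕ_) (ℕ.*-comm s p) pj∣sp)))

  n<m^n : ∀ {m} → 1 < m → ∀ n → n < m ℕ.^ n
  n<m^n 1<m zero    = s≤s z≤n
  n<m^n {m} 1<m (suc n) = ℕ.≤-<-trans (n<m^n 1<m n) (ℕ.^-monoʳ-< m 1<m (ℕ.n<1+n n))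

  n*m≡m+[n∸1]*m : ∀ p .{{_ : NonZero p}} m → p ℕ.* m ≡ m ℕ.+ (p ∸ 1) ℕ.* m
  n*m≡m+[n∸1]*m (suc k) m = refl

  module GeneratingFunction (p : ℕ) .{{_ : ℕ.NonTrivial p}} (m : ℕ) where

    private instance
      p≢0 : NonZero p
      p≢0 = ℕ.nonTrivial⇒nonZero p

    open AtkinOperators p
    open ≋-Reasoning

    ℓ : ℕ
    ℓ = (p ∸ 1) ℕ.* m

    partial truncated : ℕ → PowerSeries
    partial   N = toℤ (partialProd p ℓ N)
    truncated N = toℤ (genTrunc p m N)

    A D E : PowerSeries
    A = geometric 1 ^ m
    D = geometric 1 ^ (p ℕ.* m)
    E = geometric p ^ m

    truncated≋ : ∀ N → truncated N ≋ A ⊙ partial N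
    truncated≋ N = ≋-trans (toℤ-⊛ _ _) (*-congʳ (toℤ-^ˢ _ m))

    partial-suc : ∀ N → partial (suc N) ≋ partial N ⊙ geometric (p ℕ.^ N) ^ ℓ
    partial-suc N = ≋-trans (toℤ-⊛ _ _) (*-congˡ (toℤ-^ˢ _ ℓ))

    partial-suc-V : ∀ N → partial (suc N) ≋ geometric 1 ^ ℓ ⊙ V (partial N)
    partial-suc-V zero = begin
      partial 1                    ≈⟨ partial-suc 0 ⟩
      partial 0 ⊙ geometric 1 ^ ℓ  ≈⟨ *-comm _ _ ⟩
      geometric 1 ^ ℓ ⊙ partial 0  ≈⟨ *-congˡ (≋-trans toℤ-one (≋-sym V-𝟙)) ⟩
      geometric 1 ^ ℓ ⊙ V 𝟙        ≈⟨ *-congˡ (V-cong (≋-sym toℤ-one)) ⟩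
      geometric 1 ^ ℓ ⊙ V (partial 0) ∎
    partial-suc-V (suc N) = begin
      partial (2 ℕ.+ N)                                             ≈⟨ partial-suc (suc N) ⟩
      partial (suc N) ⊙ geometric (p ℕ.* p ℕ.^ N) ^ ℓ               ≈⟨ *-cong (partial-suc-V N) (^-congˡ ℓ (≋-sym (V-geometric (p ℕ.^ N)))) ⟩
      (geometric 1 ^ ℓ ⊙ V (partial N)) ⊙ V (geometric (p ℕ.^ N)) ^ ℓ ≈⟨ *-assoc _ _ _ ⟩
      geometric 1 ^ ℓ ⊙ (V (partial N) ⊙ V (geometric (p ℕ.^ N)) ^ ℓ) ≈⟨ *-congˡ (*-congˡ (≋-sym (V-^ _ ℓ))) ⟩
      geometric 1 ^ ℓ ⊙ (V (partial N) ⊙ V (geometric (p ℕ.^ N) ^ ℓ)) ≈⟨ *-congˡ (≋-sym (V-⊙ _ _)) ⟩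
      geometric 1 ^ ℓ ⊙ V (partial N ⊙ geometric (p ℕ.^ N) ^ ℓ)      ≈⟨ *-congˡ (V-cong (≋-sym (partial-suc N))) ⟩
      geometric 1 ^ ℓ ⊙ V (partial (suc N))                         ∎

    E≋VA : E ≋ V A
    E≋VA = begin
      geometric p ^ m          ≈⟨ ^-congˡ m (≋-reflexive (cong geometric (sym (ℕ.*-identityʳ p)))) ⟩
      geometric (p ℕ.* 1) ^ m  ≈⟨ ^-congˡ m (≋-sym (V-geometric 1)) ⟩
      V (geometric 1) ^ m      ≈⟨ ≋-sym (V-^ _ m) ⟩
      V A                      ∎

    truncated-suc-V : ∀ N → truncated (suc N) ≋ D ⊙ V (partial N)
    truncated-suc-V N = begin
      truncated (suc N)                          ≈⟨ truncated≋ (suc N) ⟩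
      A ⊙ partial (suc N)                        ≈⟨ *-congˡ (partial-suc-V N) ⟩
      A ⊙ (geometric 1 ^ ℓ ⊙ V (partial N))      ≈⟨ ≋-sym (*-assoc _ _ _) ⟩
      (A ⊙ geometric 1 ^ ℓ) ⊙ V (partial N)      ≈⟨ *-congʳ (≋-sym (^-homo-* (geometric 1) m ℓ)) ⟩
      geometric 1 ^ (m ℕ.+ ℓ) ⊙ V (partial N)    ≈⟨ *-congʳ (≋-reflexive (cong (geometric 1 ^_) (sym (n*m≡m+[n∸1]*m p m)))) ⟩
      D ⊙ V (partial N)                          ∎

    truncated-functional-equation : ∀ N → truncated (suc N) ⊙ E ≋ D ⊙ V (truncated N)
    truncated-functional-equation N = begin
      truncated (suc N) ⊙ E         ≈⟨ *-congʳ (truncated-suc-V N) ⟩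
      (D ⊙ V (partial N)) ⊙ E       ≈⟨ *-assoc _ _ _ ⟩
      D ⊙ (V (partial N) ⊙ E)       ≈⟨ *-congˡ (*-comm _ _) ⟩
      D ⊙ (E ⊙ V (partial N))       ≈⟨ *-congˡ (*-congʳ E≋VA) ⟩
      D ⊙ (V A ⊙ V (partial N))     ≈⟨ *-congˡ (≋-sym (V-⊙ _ _)) ⟩
      D ⊙ V (A ⊙ partial N)         ≈⟨ *-congˡ (V-cong (≋-sym (truncated≋ N))) ⟩
      D ⊙ V (truncated N)           ∎

    InXᵖ-E : InXᵖ E
    InXᵖ-E = InXᵖ-resp-≋ (≋-sym E≋VA) (InXᵖ-V A)

    U-E : U E ≋ A
    U-E = ≋-trans (U-cong E≋VA) (U∘V A)

    U-functional-equation : ∀ N → A ⊙ U (truncated (suc N)) ≋ truncated N ⊙ U D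
    U-functional-equation N = begin
      A ⊙ U (truncated (suc N))        ≈⟨ *-congʳ (≋-sym U-E) ⟩
      U E ⊙ U (truncated (suc N))      ≈⟨ ≋-sym (U-⊙ _ InXᵖ-E) ⟩
      U (E ⊙ truncated (suc N))        ≈⟨ U-cong (*-comm _ _) ⟩
      U (truncated (suc N) ⊙ E)        ≈⟨ U-cong (truncated-functional-equation N) ⟩
      U (D ⊙ V (truncated N))          ≈⟨ U-cong (*-comm _ _) ⟩
      U (V (truncated N) ⊙ D)          ≈⟨ U-⊙ D (InXᵖ-V _) ⟩
      U (V (truncated N)) ⊙ U D        ≈⟨ *-congʳ (U∘V _) ⟩
      truncated N ⊙ U D                ∎

    truncated-suc : ∀ N → truncated (suc N) ≋ truncated N ⊙ geometric (p ℕ.^ N) ^ ℓ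
    truncated-suc N = begin
      truncated (suc N)                               ≈⟨ truncated≋ (suc N) ⟩
      A ⊙ partial (suc N)                             ≈⟨ *-congˡ (partial-suc N) ⟩
      A ⊙ (partial N ⊙ geometric (p ℕ.^ N) ^ ℓ)       ≈⟨ ≋-sym (*-assoc _ _ _) ⟩
      (A ⊙ partial N) ⊙ geometric (p ℕ.^ N) ^ ℓ       ≈⟨ *-congʳ (≋-sym (truncated≋ N)) ⟩
      truncated N ⊙ geometric (p ℕ.^ N) ^ ℓ           ∎

    truncated-stable : ∀ N → truncated (suc N) ≋[< p ℕ.^ N ] truncated N
    truncated-stable N n n<pᴺ = trans (truncated-suc N n)
      (trans (⊙-cong-< (λ _ _ → refl) (^-cong-< ℓ (geometric≋[<]𝟙 (p ℕ.^ N) {{ℕ.m^n≢0 p N}})) n n<pᴺ)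
             (trans (*-congˡ (𝟙^≋𝟙 ℓ) n) (⊙-identityʳ _ n)))

    truncated≡d : ∀ N n → n < N → truncated N n ≡ + d p m n
    truncated≡d (suc N) n n<1+N with ℕ.m<1+n⇒m<n∨m≡n n<1+N
    ... | inj₁ n<N  = trans (truncated-stable N n (ℕ.<-trans n<N (n<m^n (ℕ.nonTrivial⇒n>1 p) N)))
                            (truncated≡d N n n<N)
    ... | inj₂ refl = refl

    A₀≡1 : A 0 ≡ 1ℤ
    A₀≡1 = trans (^-cong-< m (geometric≋[<]𝟙 1) 0 (s≤s z≤n)) (𝟙^≋𝟙 m 0)

    d-congruence : ∀ {q} → q ∣ₛ U (D ⊕ ⊖ E) → ∀ n → q ∣ + d p m (n ℕ.* p) - + d p m n
    d-congruence {q} q∣U[D-E] n = subst (q ∣_)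
      (cong₂ _-_ (truncated≡d (suc N) (n ℕ.* p) (s≤s (ℕ.n≤1+n _))) (truncated≡d N n (s≤s (ℕ.m≤m*n n p))))
      (∣ₛ-cancel-unitˡ A difference A₀≡1 (∣ₛ-resp-≋ (≋-sym A⊙difference) (∣ₛ-⊙ʳ (truncated N) q∣U[D-E])) n)
      where
      N = suc (n ℕ.* p)
      difference = U (truncated (suc N)) ⊕ ⊖ truncated N
      A⊙difference : A ⊙ difference ≋ truncated N ⊙ U (D ⊕ ⊖ E)
      A⊙difference = begin
        A ⊙ (U (truncated (suc N)) ⊕ ⊖ truncated N)       ≈⟨ x[y-z]≈xy-xz A _ _ ⟩
        A ⊙ U (truncated (suc N)) ⊕ ⊖ (A ⊙ truncated N)   ≈⟨ +-cong (U-functional-equation N) (λ k → cong -_ (*-comm A _ k)) ⟩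
        truncated N ⊙ U D ⊕ ⊖ (truncated N ⊙ A)           ≈⟨ +-cong (≋-refl {truncated N ⊙ U D}) (λ k → cong -_ (*-congˡ (≋-sym U-E) k)) ⟩
        truncated N ⊙ U D ⊕ ⊖ (truncated N ⊙ U E)         ≈⟨ ≋-sym (x[y-z]≈xy-xz (truncated N) (U D) (U E)) ⟩
        truncated N ⊙ U (D ⊕ ⊖ E)                         ∎

  [1+k]*[1+n]C[1+k]≡[1+n]*nCk : ∀ n k → suc k ℕ.* (suc n C suc k) ≡ suc n ℕ.* (n C k)
  [1+k]*[1+n]C[1+k]≡[1+n]*nCk zero    zero    = refl
  [1+k]*[1+n]C[1+k]≡[1+n]*nCk zero    (suc k) = ℕ.*-zeroʳ (2 ℕ.+ k)
  [1+k]*[1+n]C[1+k]≡[1+n]*nCk (suc n) zero    = trans (ℕ.+-identityʳ _) (trans (nC1≡n (2 ℕ.+ n)) (sym (ℕ.*-identityʳ (2 ℕ.+ n))))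
  [1+k]*[1+n]C[1+k]≡[1+n]*nCk (suc n) (suc k) = begin
    (2 ℕ.+ k) ℕ.* ((2 ℕ.+ n) C (2 ℕ.+ k))                      ≡⟨ cong ((2 ℕ.+ k) ℕ.*_) (nCk+nC[k+1]≡[n+1]C[k+1] (suc n) (suc k)) ⟨
    (2 ℕ.+ k) ℕ.* (a ℕ.+ b)                                    ≡⟨ ℕ.*-distribˡ-+ (2 ℕ.+ k) a b ⟩
    a ℕ.+ suc k ℕ.* a ℕ.+ (2 ℕ.+ k) ℕ.* b                      ≡⟨ cong₂ (λ x y → a ℕ.+ x ℕ.+ y) ([1+k]*[1+n]C[1+k]≡[1+n]*nCk n k) ([1+k]*[1+n]C[1+k]≡[1+n]*nCk n (suc k)) ⟩
    a ℕ.+ suc n ℕ.* (n C k) ℕ.+ suc n ℕ.* (n C suc k)          ≡⟨ ℕ.+-assoc a _ _ ⟩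
    a ℕ.+ (suc n ℕ.* (n C k) ℕ.+ suc n ℕ.* (n C suc k))        ≡⟨ cong (a ℕ.+_) (ℕ.*-distribˡ-+ (suc n) (n C k) (n C suc k)) ⟨
    a ℕ.+ suc n ℕ.* (n C k ℕ.+ n C suc k)                      ≡⟨ cong (λ c → a ℕ.+ suc n ℕ.* c) (nCk+nC[k+1]≡[n+1]C[k+1] n k) ⟩
    (2 ℕ.+ n) ℕ.* a                                            ∎
    where
    open ≡-Reasoning
    a = suc n C suc k
    b = suc n C suc (suc k)

  p∣pCk : ∀ {p k} → Prime p → 0 < k → k < p → p ∣ℕ p C k
  p∣pCk {suc n} {suc k} p-prime _ k<p
    with euclidsLemma (suc k) (suc n C suc k) p-prime
           (subst (suc n ∣ℕ_) (sym ([1+k]*[1+n]C[1+k]≡[1+n]*nCk n k)) (ℕ∣.m∣m*n (n C k)))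
  ... | inj₂ p∣pCk = p∣pCk
  ... | inj₁ p∣k   = ⊥-elim (ℕ.<⇒≱ k<p (ℕ∣.∣⇒≤ p∣k))

  -1^odd : ∀ n → ¬ 2 ∣ℕ n → -1ℤ ℤ^ n ≡ -1ℤ
  -1^odd zero          2∤0   = ⊥-elim (2∤0 (2 ℕ∣.∣0))
  -1^odd 1             _     = refl
  -1^odd (suc (suc n)) 2∤2+n = begin
    -1ℤ * (-1ℤ * -1ℤ ℤ^ n) ≡⟨ ℤ.-1*i≡-i _ ⟩
    - (-1ℤ * -1ℤ ℤ^ n)     ≡⟨ cong -_ (ℤ.-1*i≡-i _) ⟩
    - - (-1ℤ ℤ^ n)          ≡⟨ ℤ.neg-involutive _ ⟩
    -1ℤ ℤ^ n               ≡⟨ -1^odd n (λ 2∣n → 2∤2+n (ℕ∣.∣m∣n⇒∣m+n ℕ∣.∣-refl 2∣n)) ⟩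
    -1ℤ                    ∎
    where open ≡-Reasoning

  1-x : PowerSeries
  1-x zero          = 1ℤ
  1-x 1             = -1ℤ
  1-x (suc (suc _)) = 0ℤ

  [1-x]⊙-suc : ∀ g n → (1-x ⊙ g) (suc n) ≡ g (suc n) - g n
  [1-x]⊙-suc g n = cong₂ _+_ (ℤ.*-identityˡ (g (suc n))) (-x⊙g n)
    where
    -x⊙g : ∀ n → (tail 1-x ⊙ g) n ≡ - g n
    -x⊙g zero    = ℤ.-1*i≡-i (g 0)
    -x⊙g (suc n) = begin
      -1ℤ * g (suc n) + (tail (tail 1-x) ⊙ g) n ≡⟨ cong₂ _+_ (ℤ.-1*i≡-i (g (suc n))) (⊙-termwise-zero _ g n (λ i _ → refl)) ⟩
      - g (suc n) + 0ℤ                          ≡⟨ ℤ.+-identityʳ _ ⟩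
      - g (suc n)                               ∎
      where open ≡-Reasoning

  [1-x]^-coefficient : ∀ e n → (1-x ^ e) n ≡ -1ℤ ℤ^ n * + (e C n)
  [1-x]^-coefficient zero    zero    = refl
  [1-x]^-coefficient zero    (suc n) = sym (ℤ.*-zeroʳ (-1ℤ ℤ^ suc n))
  [1-x]^-coefficient (suc e) zero    = trans (ℤ.*-identityˡ _) ([1-x]^-coefficient e 0)
  [1-x]^-coefficient (suc e) (suc n) = begin
    (1-x ⊙ 1-x ^ e) (suc n)                                 ≡⟨ [1-x]⊙-suc (1-x ^ e) n ⟩
    (1-x ^ e) (suc n) - (1-x ^ e) n                         ≡⟨ cong₂ _-_ ([1-x]^-coefficient e (suc n)) ([1-x]^-coefficient e n) ⟩
    -1ℤ * s * + (e C suc n) - s * + (e C n)                 ≡⟨ collect s (+ (e C suc n)) (+ (e C n)) ⟩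
    -1ℤ * s * (+ (e C n) + + (e C suc n))                   ≡⟨ cong (λ c → -1ℤ * s * c) (ℤ.pos-+ (e C n) (e C suc n)) ⟨
    -1ℤ * s * + (e C n ℕ.+ e C suc n)                       ≡⟨ cong (λ c → -1ℤ * s * + c) (nCk+nC[k+1]≡[n+1]C[k+1] e n) ⟩
    -1ℤ * s * + (suc e C suc n)                             ∎
    where
    open ≡-Reasoning
    s = -1ℤ ℤ^ n
    collect : ∀ s a b → -1ℤ * s * a - s * b ≡ -1ℤ * s * (b + a)
    collect = solve-∀

  [1-x]⊙geometric≋𝟙 : 1-x ⊙ geometric 1 ≋ 𝟙
  [1-x]⊙geometric≋𝟙 zero    = refl
  [1-x]⊙geometric≋𝟙 (suc n) = begin
    (1-x ⊙ geometric 1) (suc n)          ≡⟨ [1-x]⊙-suc (geometric 1) n ⟩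
    geometric 1 (suc n) - geometric 1 n  ≡⟨ cong₂ _-_ (geometric-∣ (ℕ∣.1∣ suc n)) (geometric-∣ (ℕ∣.1∣ n)) ⟩
    0ℤ                                   ∎
    where open ≡-Reasoning

  ×≋⋆ : ∀ c f → c × f ≋ + c ⋆ f
  ×≋⋆ zero    f n = sym (ℤ.*-zeroˡ (f n))
  ×≋⋆ (suc c) f n = trans (cong (_+_ (f n)) (×≋⋆ c f n)) (factor (+ c) (f n))
    where
    factor : ∀ c y → y + c * y ≡ (1ℤ + c) * y
    factor = solve-∀

  ^-⊖-^ : ∀ n A B → A ^ n ⊕ ⊖ B ^ n ≋ Σₛ (λ (i : Fin n) → binomialTerm (A ⊕ ⊖ B) B n (Fin.suc i))
  ^-⊖-^ n A B = begin
    A ^ n ⊕ ⊖ B ^ n                                 ≈⟨ +-cong (^-congˡ n A≋X+B) ≋-refl ⟩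
    (X ⊕ B) ^ n ⊕ ⊖ B ^ n                           ≈⟨ +-cong (binomial-theorem n X B) ≋-refl ⟩
    binomialTerm X B n Fin.zero ⊕ Σₛ term ⊕ ⊖ B ^ n ≈⟨ +-cong (+-cong term₀≋B^n ≋-refl) ≋-refl ⟩
    B ^ n ⊕ Σₛ term ⊕ ⊖ B ^ n                       ≈⟨ solve 2 (λ b s → b :+ s :- b := s) ≋-refl (B ^ n) (Σₛ term) ⟩
    Σₛ term                                         ∎
    where
    open ≋-Reasoning
    open ⊙-Solver using (solve; _:+_; _:-_; _:=_)
    X = A ⊕ ⊖ B
    term : Fin n → PowerSeries
    term i = binomialTerm X B n (Fin.suc i)
    A≋X+B : A ≋ X ⊕ B
    A≋X+B = solve 2 (λ a b → a := (a :- b) :+ b) ≋-refl A B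
    term₀≋B^n : binomialTerm X B n Fin.zero ≋ B ^ n
    term₀≋B^n k = trans (×≋⋆ 1 (𝟙 ⊙ B ^ n) k) (trans (ℤ.*-identityˡ _) (⊙-identityˡ (B ^ n) k))

  j+m≤[1+k]*j : ∀ {j k m} → 1 ≤ j → m ≤ k → j ℕ.+ m ≤ suc k ℕ.* j
  j+m≤[1+k]*j {j} {k} {m} 1≤j m≤k =
    ℕ.+-monoʳ-≤ j (subst (_≤ k ℕ.* j) (ℕ.*-identityʳ m) (ℕ.*-mono-≤ m≤k 1≤j))

  module Lifting (p : ℕ) (p-prime : Prime p) (3≤p : 3 ≤ p) where

    private instance
      p≢0 : NonZero p
      p≢0 = prime⇒nonZero p-prime

    open AtkinOperators p

    p^ᶻ_ : ℕ → ℤ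
    p^ᶻ j = + (p ℕ.^ j)

    p^ᶻ-+ : ∀ i j → p^ᶻ (i ℕ.+ j) ≡ p^ᶻ i * p^ᶻ j
    p^ᶻ-+ i j = trans (cong +_ (ℕ.^-distribˡ-+-* p i j)) (ℤ.pos-* (p ℕ.^ i) (p ℕ.^ j))

    p^ᶻ-mono-∣ : ∀ {i j} → i ≤ j → p^ᶻ i ∣ p^ᶻ j
    p^ᶻ-mono-∣ {i} {j} i≤j = ∣ᵤ⇒∣ (subst (p ℕ.^ i ∣ℕ_) pⁱ*pʲ⁻ⁱ≡pʲ (ℕ∣.m∣m*n (p ℕ.^ (j ∸ i))))
      where
      pⁱ*pʲ⁻ⁱ≡pʲ : p ℕ.^ i ℕ.* p ℕ.^ (j ∸ i) ≡ p ℕ.^ j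
      pⁱ*pʲ⁻ⁱ≡pʲ = trans (sym (ℕ.^-distribˡ-+-* p i (j ∸ i))) (cong (p ℕ.^_) (ℕ.m+[n∸m]≡n i≤j))

    infix 4 p^_∣ₛ_ p^_∣ₛ⁺_

    p^_∣ₛ_ : ℕ → PowerSeries → Set
    p^ j ∣ₛ f = p^ᶻ j ∣ₛ f

    ∣ₛ-weaken : ∀ {i j f} → i ≤ j → p^ j ∣ₛ f → p^ i ∣ₛ f
    ∣ₛ-weaken {i} {j} i≤j p^j∣f n = ∣-trans (p^ᶻ-mono-∣ {i} {j} i≤j) (p^j∣f n)

    ∣ₛ-⊙-p^ : ∀ {i j f g} → p^ i ∣ₛ f → p^ j ∣ₛ g → p^ (i ℕ.+ j) ∣ₛ f ⊙ g
    ∣ₛ-⊙-p^ {i} {j} p^i∣f p^j∣g n = subst (_∣ _) (sym (p^ᶻ-+ i j)) (∣ₛ-⊙ p^i∣f p^j∣g n)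

    ∣ₛ-^ : ∀ {j f} n → p^ j ∣ₛ f → p^ (n ℕ.* j) ∣ₛ f ^ n
    ∣ₛ-^ zero    _     n = ∣ᵤ⇒∣ (ℕ∣.1∣ _)
    ∣ₛ-^ {j} (suc n) p^j∣f = ∣ₛ-⊙-p^ {j} {n ℕ.* j} p^j∣f (∣ₛ-^ {j} n p^j∣f)

    ∣ₛ-⋆ : ∀ {j c f} → + p ∣ c → p^ j ∣ₛ f → p^ suc j ∣ₛ c ⋆ f
    ∣ₛ-⋆ {j} {c} p∣c p^j∣f n = subst (_∣ (c * _)) (sym (ℤ.pos-* p (p ℕ.^ j))) (*-pres-∣ p∣c (p^j∣f n))

    p^_∣ₛ⁺_ : ℕ → PowerSeries → Set
    p^ j ∣ₛ⁺ f = p^ j ∣ₛ f ∧ p^ suc j ∣ₛ U f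

    ∣ₛ⁺-resp-≋ : ∀ {j f g} → f ≋ g → p^ j ∣ₛ⁺ f → p^ j ∣ₛ⁺ g
    ∣ₛ⁺-resp-≋ {j} f≋g (f₁ , f₂) = ∣ₛ-resp-≋ {p^ᶻ j} f≋g f₁ , ∣ₛ-resp-≋ {p^ᶻ suc j} (U-cong f≋g) f₂

    ∣ₛ⁺-⊕ : ∀ {j f g} → p^ j ∣ₛ⁺ f → p^ j ∣ₛ⁺ g → p^ j ∣ₛ⁺ f ⊕ g
    ∣ₛ⁺-⊕ {j} (f₁ , f₂) (g₁ , g₂) = ∣ₛ-⊕ {p^ᶻ j} f₁ g₁ , ∣ₛ-⊕ {p^ᶻ suc j} f₂ g₂

    ∣ₛ⁺-𝟘 : ∀ {j} → p^ j ∣ₛ⁺ 𝟘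
    ∣ₛ⁺-𝟘 {j} = (λ _ → ∣ᵤ⇒∣ ((p ℕ.^ j) ℕ∣.∣0)) , (λ _ → ∣ᵤ⇒∣ ((p ℕ.^ suc j) ℕ∣.∣0))

    ∣ₛ⁺-Σ : ∀ {j n} (f : Fin n → PowerSeries) → (∀ i → p^ j ∣ₛ⁺ f i) → p^ j ∣ₛ⁺ Σₛ f
    ∣ₛ⁺-Σ {j} {zero}  f _     = ∣ₛ⁺-𝟘 {j}
    ∣ₛ⁺-Σ {j} {suc n} f f-div = ∣ₛ⁺-⊕ {j} (f-div Fin.zero) (∣ₛ⁺-Σ {j} (λ i → f (Fin.suc i)) (λ i → f-div (Fin.suc i)))

    ∣ₛ⇒∣ₛ⁺ : ∀ {j f} → p^ suc j ∣ₛ f → p^ j ∣ₛ⁺ f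
    ∣ₛ⇒∣ₛ⁺ {j} p^j+1∣f = ∣ₛ-weaken {j} (ℕ.n≤1+n j) p^j+1∣f , λ s → p^j+1∣f (s ℕ.* p)

    ∣ₛ⁺-InXᵖ-⊙ : ∀ {j f g} → InXᵖ f → p^ j ∣ₛ⁺ g → p^ j ∣ₛ⁺ f ⊙ g
    ∣ₛ⁺-InXᵖ-⊙ {j} {f} {g} f∈ (g₁ , g₂) =
      ∣ₛ-⊙ʳ {p^ᶻ j} f g₁ , ∣ₛ-resp-≋ {p^ᶻ suc j} (≋-sym (U-⊙ g f∈)) (∣ₛ-⊙ʳ {p^ᶻ suc j} (U f) g₂)

    ∣ₛ⁺-p⋆ : ∀ {j f} → p^ j ∣ₛ⁺ f → p^ suc j ∣ₛ⁺ + p ⋆ f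
    ∣ₛ⁺-p⋆ {j} (f₁ , f₂) = ∣ₛ-⋆ {j} ∣-refl f₁ , ∣ₛ-⋆ {suc j} ∣-refl f₂

    infix 4 _≃[_]_

    _≃[_]_ : PowerSeries → ℕ → PowerSeries → Set
    A ≃[ j ] B = InXᵖ B ∧ p^ j ∣ₛ⁺ A ⊕ ⊖ B

    ≃-resp-≋ : ∀ {j A A′ B B′} → A ≋ A′ → B ≋ B′ → A ≃[ j ] B → A′ ≃[ j ] B′
    ≃-resp-≋ {j} A≋A′ B≋B′ (B∈ , A-B) =
      InXᵖ-resp-≋ B≋B′ B∈ , ∣ₛ⁺-resp-≋ {j} (+-cong A≋A′ (λ n → cong -_ (B≋B′ n))) A-B

    ≃-refl : ∀ {j B} → InXᵖ B → B ≃[ j ] B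
    ≃-refl {j} {B} B∈ = B∈ , ∣ₛ⁺-resp-≋ {j} (λ n → sym (ℤ.+-inverseʳ (B n))) (∣ₛ⁺-𝟘 {j})

    ≃-⊙ : ∀ {j A₁ A₂ B₁ B₂} → 1 ≤ j → A₁ ≃[ j ] B₁ → A₂ ≃[ j ] B₂ → A₁ ⊙ A₂ ≃[ j ] B₁ ⊙ B₂
    ≃-⊙ {j} {A₁} {A₂} {B₁} {B₂} 1≤j (B₁∈ , X₁) (B₂∈ , X₂) = InXᵖ-⊙ B₁∈ B₂∈ ,
      ∣ₛ⁺-resp-≋ {j} (≋-sym expand)
        (∣ₛ⁺-⊕ {j} (∣ₛ⁺-⊕ {j} (∣ₛ⁺-InXᵖ-⊙ {j} B₁∈ X₂) (∣ₛ⁺-InXᵖ-⊙ {j} B₂∈ X₁))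
                     (∣ₛ⇒∣ₛ⁺ {j} (∣ₛ-weaken {suc j} {j ℕ.+ j} (ℕ.+-monoˡ-≤ j 1≤j) (∣ₛ-⊙-p^ {j} {j} (proj₁ X₁) (proj₁ X₂)))))
      where
      open ⊙-Solver using (solve; _:*_; _:+_; _:-_; _:=_)
      expand : A₁ ⊙ A₂ ⊕ ⊖ (B₁ ⊙ B₂) ≋ B₁ ⊙ (A₂ ⊕ ⊖ B₂) ⊕ B₂ ⊙ (A₁ ⊕ ⊖ B₁) ⊕ (A₁ ⊕ ⊖ B₁) ⊙ (A₂ ⊕ ⊖ B₂)
      expand = solve 4 (λ a₁ a₂ b₁ b₂ → a₁ :* a₂ :- b₁ :* b₂ := b₁ :* (a₂ :- b₂) :+ b₂ :* (a₁ :- b₁) :+ (a₁ :- b₁) :* (a₂ :- b₂))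
                     ≋-refl A₁ A₂ B₁ B₂

    ≃-^ : ∀ {j A B} → 1 ≤ j → A ≃[ j ] B → ∀ n → A ^ n ≃[ j ] B ^ n
    ≃-^ {j} 1≤j A≃B zero    = ≃-refl {j} InXᵖ-𝟙
    ≃-^ {j} 1≤j A≃B (suc n) = ≃-⊙ {j} 1≤j A≃B (≃-^ {j} 1≤j A≃B n)

    binomialTerm-∣ₛ⁺ : ∀ {j A B} → 1 ≤ j → A ≃[ j ] B → ∀ t → t < p →
                       p^ suc j ∣ₛ⁺ (p C suc t) × ((A ⊕ ⊖ B) ^ suc t ⊙ B ^ (p ∸ suc t))
    binomialTerm-∣ₛ⁺ {j} {A} {B} 1≤j (B∈ , X-div) zero _ =
      ∣ₛ⁺-resp-≋ {suc j} (≋-sym p-term) (∣ₛ⁺-p⋆ {j} (∣ₛ⁺-resp-≋ {j} (*-comm _ _)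
        (∣ₛ⁺-InXᵖ-⊙ {j} (InXᵖ-^ (p ∸ 1) B∈) (∣ₛ⁺-resp-≋ {j} (≋-sym (⊙-identityʳ X)) X-div))))
      where
      X = A ⊕ ⊖ B
      p-term : (p C 1) × (X ^ 1 ⊙ B ^ (p ∸ 1)) ≋ + p ⋆ (X ^ 1 ⊙ B ^ (p ∸ 1))
      p-term n = trans (×≋⋆ (p C 1) _ n) (cong (λ c → + c * (X ^ 1 ⊙ B ^ (p ∸ 1)) n) (nC1≡n p))
    binomialTerm-∣ₛ⁺ {j} {A} {B} 1≤j (B∈ , X-div) (suc t) t<p =
      ∣ₛ⇒∣ₛ⁺ {suc j} (∣ₛ-resp-≋ {p^ᶻ (2 ℕ.+ j)} (≋-sym (×≋⋆ (p C k) _)) (p^j+2∣ₛ (ℕ.m≤n⇒m<n∨m≡n t<p)))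
      where
      k = 2 ℕ.+ t
      Y = (A ⊕ ⊖ B) ^ k ⊙ B ^ (p ∸ k)
      p^kj∣ₛ : p^ (k ℕ.* j) ∣ₛ Y
      p^kj∣ₛ = ∣ₛ-⊙ˡ {p^ᶻ (k ℕ.* j)} (B ^ (p ∸ k)) (∣ₛ-^ {j} k (proj₁ X-div))
      p^j+2∣ₛ : k < p ⊎ k ≡ p → p^ (2 ℕ.+ j) ∣ₛ + (p C k) ⋆ Y
      p^j+2∣ₛ (inj₁ k<p) = ∣ₛ-weaken {2 ℕ.+ j} {suc (k ℕ.* j)} {+ (p C k) ⋆ Y} 2+j≤1+kj
        (∣ₛ-⋆ {k ℕ.* j} {+ (p C k)} {Y} (∣ᵤ⇒∣ (p∣pCk p-prime (s≤s z≤n) k<p)) p^kj∣ₛ)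
        where
        2+j≤1+kj : 2 ℕ.+ j ≤ suc (k ℕ.* j)
        2+j≤1+kj = s≤s (subst (_≤ k ℕ.* j) (ℕ.+-comm j 1) (j+m≤[1+k]*j {j} {suc t} 1≤j (s≤s z≤n)))
      p^j+2∣ₛ (inj₂ k≡p) = ∣ₛ-weaken {2 ℕ.+ j} {k ℕ.* j} {+ (p C k) ⋆ Y} 2+j≤kj
        (λ n → ∣n⇒∣m*n (+ (p C k)) (p^kj∣ₛ n))
        where
        2+j≤kj : 2 ℕ.+ j ≤ k ℕ.* j
        2+j≤kj = subst (2 ℕ.+ j ≤_) (cong (ℕ._* j) (sym k≡p))
          (ℕ.≤-trans (subst (_≤ 3 ℕ.* j) (ℕ.+-comm j 2) (j+m≤[1+k]*j 1≤j ℕ.≤-refl)) (ℕ.*-monoˡ-≤ j 3≤p))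

    ≃-^p : ∀ {j A B} → 1 ≤ j → A ≃[ j ] B → A ^ p ≃[ suc j ] B ^ p
    ≃-^p {j} {A} {B} 1≤j A≃B = InXᵖ-^ p (proj₁ A≃B) ,
      ∣ₛ⁺-resp-≋ {suc j} (≋-sym (^-⊖-^ p A B))
        (∣ₛ⁺-Σ {suc j} (λ i → binomialTerm (A ⊕ ⊖ B) B p (Fin.suc i))
                       (λ i → binomialTerm-∣ₛ⁺ {j} {A} {B} 1≤j A≃B (toℕ i) (toℕ<n i)))

    p-odd : ¬ 2 ∣ℕ p
    p-odd 2∣p with prime⇒irreducible p-prime 2∣p
    ... | inj₁ ()
    ... | inj₂ 2≡p = ℕ.<-irrefl 2≡p 3≤p

    R : PowerSeries
    R = 1-x ^ p ⊕ ⊖ V 1-x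

    U-R : U R ≋ 𝟘
    U-R s = trans (cong₂ _-_ ([1-x]^-coefficient p (s ℕ.* p)) (U∘V 1-x s)) (coefficient≡0 s)
      where
      coefficient≡0 : ∀ s → -1ℤ ℤ^ (s ℕ.* p) * + (p C (s ℕ.* p)) - 1-x s ≡ 0ℤ
      coefficient≡0 zero          = refl
      coefficient≡0 1             = begin
        -1ℤ ℤ^ (p ℕ.+ 0) * + (p C (p ℕ.+ 0)) - -1ℤ ≡⟨ cong (λ n → -1ℤ ℤ^ n * + (p C n) - -1ℤ) (ℕ.+-identityʳ p) ⟩
        -1ℤ ℤ^ p * + (p C p) - -1ℤ                 ≡⟨ cong₂ (λ a c → a * + c - -1ℤ) (-1^odd p p-odd) (nCn≡1 p) ⟩
        0ℤ                                         ∎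
        where open ≡-Reasoning
      coefficient≡0 (suc (suc s)) = begin
        -1ℤ ℤ^ n * + (p C n) - 0ℤ  ≡⟨ cong (λ c → -1ℤ ℤ^ n * + c - 0ℤ) (k>n⇒nCk≡0 (ℕ.m<m+n p (ℕ.<-≤-trans (ℕ.>-nonZero⁻¹ p) (ℕ.m≤m+n p (s ℕ.* p))))) ⟩
        -1ℤ ℤ^ n * 0ℤ - 0ℤ        ≡⟨ cong (_- 0ℤ) (ℤ.*-zeroʳ (-1ℤ ℤ^ n)) ⟩
        0ℤ                        ∎
        where
        open ≡-Reasoning
        n = suc (suc s) ℕ.* p

    p∣ₛR : p^ 1 ∣ₛ R
    p∣ₛR n = p∣R (p ∣? n)
      where
      p∣pCn : ∀ n → ¬ p ∣ℕ n → p ∣ℕ p C n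
      p∣pCn zero    p∤0 = ⊥-elim (p∤0 (p ℕ∣.∣0))
      p∣pCn (suc n) p∤n with ℕ.<-cmp (suc n) p
      ... | tri< n<p _ _  = p∣pCk p-prime (s≤s z≤n) n<p
      ... | tri≈ _ refl _ = ⊥-elim (p∤n ℕ∣.∣-refl)
      ... | tri> _ _ n>p  = subst (p ∣ℕ_) (sym (k>n⇒nCk≡0 n>p)) (p ℕ∣.∣0)
      p∣R : Dec (p ∣ℕ n) → p^ᶻ 1 ∣ R n
      p∣R (yes (divides s refl)) = subst (p^ᶻ 1 ∣_) (sym (U-R s)) (∣ᵤ⇒∣ (_ ℕ∣.∣0))
      p∣R (no  p∤n) = subst (p^ᶻ 1 ∣_) (sym (cong₂ _-_ ([1-x]^-coefficient p n) (InXᵖ-V 1-x n p∤n)))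
        (∣m∣n⇒∣m-n (∣n⇒∣m*n (-1ℤ ℤ^ n) (∣ᵤ⇒∣ (subst (_∣ℕ p C n) (sym (ℕ.*-identityʳ p)) (p∣pCn n p∤n))))
                   (∣ᵤ⇒∣ {p^ᶻ 1} {0ℤ} ((p ℕ.* 1) ℕ∣.∣0)))

    geometric^p≃geometric : geometric 1 ^ p ≃[ 1 ] geometric p
    geometric^p≃geometric = H∈ , p∣ₛX , p²∣ₛUX
      where
      open ≋-Reasoning
      open ⊙-Solver using (solve; _:+_; _:*_; _:-_; :-_; _:=_)
      G H X : PowerSeries
      G = geometric 1 ^ p
      H = geometric p
      X = G ⊕ ⊖ H

      H≋V : H ≋ V (geometric 1)
      H≋V = ≋-trans (≋-reflexive (cong geometric (sym (ℕ.*-identityʳ p)))) (≋-sym (V-geometric 1))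

      H∈ : InXᵖ H
      H∈ = InXᵖ-resp-≋ (≋-sym H≋V) (InXᵖ-V (geometric 1))

      G⊙[1-x]^p≋𝟙 : G ⊙ 1-x ^ p ≋ 𝟙
      G⊙[1-x]^p≋𝟙 = begin
        G ⊙ 1-x ^ p              ≈⟨ ≋-sym (^-distrib-* (geometric 1) 1-x p) ⟩
        (geometric 1 ⊙ 1-x) ^ p  ≈⟨ ^-congˡ p (≋-trans (*-comm _ _) [1-x]⊙geometric≋𝟙) ⟩
        𝟙 ^ p                    ≈⟨ 𝟙^≋𝟙 p ⟩
        𝟙                        ∎

      H⊙V[1-x]≋𝟙 : H ⊙ V 1-x ≋ 𝟙
      H⊙V[1-x]≋𝟙 = begin
        H ⊙ V 1-x                   ≈⟨ *-congʳ H≋V ⟩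
        V (geometric 1) ⊙ V 1-x     ≈⟨ ≋-sym (V-⊙ _ _) ⟩
        V (geometric 1 ⊙ 1-x)       ≈⟨ V-cong (≋-trans (*-comm _ _) [1-x]⊙geometric≋𝟙) ⟩
        V 𝟙                         ≈⟨ V-𝟙 ⟩
        𝟙                           ∎

      X≋-HGR : X ≋ ⊖ (H ⊙ (G ⊙ R))
      X≋-HGR = begin
        G ⊕ ⊖ H                                          ≈⟨ +-cong (⊙-identityʳ G) (λ n → cong -_ (⊙-identityʳ H n)) ⟨
        G ⊙ 𝟙 ⊕ ⊖ (H ⊙ 𝟙)                                ≈⟨ +-cong (*-congˡ H⊙V[1-x]≋𝟙) (λ n → cong -_ (*-congˡ G⊙[1-x]^p≋𝟙 n)) ⟨
        G ⊙ (H ⊙ V 1-x) ⊕ ⊖ (H ⊙ (G ⊙ 1-x ^ p))          ≈⟨ solve 4 (λ g h m l → g :* (h :* m) :- h :* (g :* l) := :- (h :* (g :* (l :- m))))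
                                                                ≋-refl G H (V 1-x) (1-x ^ p) ⟩
        ⊖ (H ⊙ (G ⊙ R))                                  ∎

      p∣ₛX : p^ 1 ∣ₛ X
      p∣ₛX = ∣ₛ-resp-≋ (≋-sym X≋-HGR) (∣ₛ-⊖ (∣ₛ-⊙ʳ H (∣ₛ-⊙ʳ G p∣ₛR)))

      p²∣ₛUX : p^ 2 ∣ₛ U X
      p²∣ₛUX = ∣ₛ-resp-≋ (U-cong (≋-sym X≋-HGR)) (∣ₛ-⊖ (∣ₛ-resp-≋ (U-cong (≋-sym HGR≋)) (∣ₛ-⊕ HHR (λ s → p²∣ₛHXR (s ℕ.* p)))))
        where
        HGR≋ : H ⊙ (G ⊙ R) ≋ H ⊙ H ⊙ R ⊕ H ⊙ (X ⊙ R)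
        HGR≋ = solve 3 (λ h g r → h :* (g :* r) := h :* h :* r :+ h :* ((g :- h) :* r)) ≋-refl H G R
        HHR : p^ 2 ∣ₛ U (H ⊙ H ⊙ R)
        HHR = ∣ₛ-resp-≋ (≋-sym (U-⊙ R (InXᵖ-⊙ H∈ H∈)))
                (∣ₛ-⊙ʳ (U (H ⊙ H)) (∣ₛ-resp-≋ (≋-sym U-R) (λ _ → ∣ᵤ⇒∣ (_ ℕ∣.∣0))))
        p²∣ₛHXR : p^ 2 ∣ₛ H ⊙ (X ⊙ R)
        p²∣ₛHXR = ∣ₛ-⊙ʳ H (∣ₛ-⊙-p^ {1} {1} p∣ₛX p∣ₛR)

    geometric^p^α≃geometric : ∀ α → (geometric 1 ^ p) ^ (p ℕ.^ α) ≃[ suc α ] geometric p ^ (p ℕ.^ α)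
    geometric^p^α≃geometric zero    = ≃-resp-≋ {1} (≋-sym (⊙-identityʳ _)) (≋-sym (⊙-identityʳ _)) geometric^p≃geometric
    geometric^p^α≃geometric (suc α) = ≃-resp-≋ {2 ℕ.+ α} (pow-pow (geometric 1 ^ p)) (pow-pow (geometric p))
      (≃-^p {suc α} (s≤s z≤n) (geometric^p^α≃geometric α))
      where
      pow-pow : ∀ f → (f ^ (p ℕ.^ α)) ^ p ≋ f ^ (p ℕ.^ suc α)
      pow-pow f = ≋-trans (^-assocʳ f (p ℕ.^ α) p) (^-congʳ f (ℕ.*-comm (p ℕ.^ α) p))

    D≃E : ∀ α k → geometric 1 ^ (p ℕ.* (p ℕ.^ α ℕ.* k)) ≃[ suc α ] geometric p ^ (p ℕ.^ α ℕ.* k)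
    D≃E α k = ≃-resp-≋ {suc α} (≋-trans (^-assocʳ _ (p ℕ.^ α) k) (^-assocʳ _ p (p ℕ.^ α ℕ.* k)))
                                (^-assocʳ _ (p ℕ.^ α) k)
      (≃-^ {suc α} (s≤s z≤n) (geometric^p^α≃geometric α) k)

  p^[α+2]∣d[pn]-d[n] : ∀ p α k → Prime p → 3 ≤ p → ∀ n →
                        + (p ℕ.^ (α ℕ.+ 2)) ∣ + d p (p ℕ.^ α ℕ.* k) (p ℕ.* n) - + d p (p ℕ.^ α ℕ.* k) n
  p^[α+2]∣d[pn]-d[n] p α k p-prime 3≤p n =
    subst₂ (λ e N → + (p ℕ.^ e) ∣ + d p m N - + d p m n) (ℕ.+-comm 2 α) (ℕ.*-comm n p)
      (d-congruence (proj₂ (proj₂ (D≃E α k))) n)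
    where
    instance _ = prime⇒nonTrivial p-prime
    m = p ℕ.^ α ℕ.* k
    open Lifting p p-prime 3≤p
    open GeneratingFunction p m

open import Data.Nat using (ℕ; _+_; _*_; _^_; _≥_)
open import Data.Nat.Primality using (Prime)
open import Data.Integer using (+_; _-_)
open import Data.Integer.Divisibility using (_∣_)
open import Data.Integer.Divisibility.Signed using (∣⇒∣ᵤ)

-- The congruence holds for all k and n.
lemma3p3 : (p α k : ℕ) → Prime p → p ≥ 3 → k ≥ 1 →
           (n : ℕ) → n ≥ 1 →
           (+ (p ^ (α + 2))) ∣ (+ d p (p ^ α * k) (p * n) - + d p (p ^ α * k) n)
lemma3p3 p α k p-prime p≥3 _ n _ = ∣⇒∣ᵤ (DmCongruence.p^[α+2]∣d[pn]-d[n] p α k p-prime p≥3 n)
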